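{- Let $k$ and $s$ be positive integers. Then, summing over tuples $(t_1,\ldots,t_s)$ of nonnegative integers, $$\sum_{t_1+2t_2+\cdots+st_s=k}\frac{(-1)^{t_1+\cdots+t_s}\,k}{t_1+\cdots+t_s}\binom{t_1+\cdots+t_s}{t_1,\ldots,t_s}=\begin{cases}s,&\text{if }k\equiv0\pmod{s+1},\\-1,&\text{otherwise}.\end{cases}$$
   Context: $\binom{t_1+\cdots+t_s}{t_1,\ldots,t_s}$ denotes the multinomial coefficient. -}

module Defs where

open import Data.Nat as ℕ using (ℕ; zero; suc; _+_; _*_; _!; NonZero; _%_; _≟_)
open import Data.Nat.Properties using (m*n≢0; _!≢0)
open import Data.Nat.DivMod using (_/_)
open import Data.Integer as ℤ using (ℤ; +_; -1ℤ)
open import Data.Rational as ℚ using (ℚ)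
open import Data.Vec as Vec using (Vec; []; _∷_)
open import Data.List as List using (List; [_]; concatMap; map; filter; upTo; foldr)
open import Relation.Nullary using (yes; no)

total : ∀ {s} → Vec ℕ s → ℕ
total [] = 0
total (x ∷ t) = x + total t

wsumFrom : ∀ {s} → ℕ → Vec ℕ s → ℕ
wsumFrom off [] = 0
wsumFrom off (x ∷ t) = off * x + wsumFrom (suc off) t

wsum : ∀ {s} → Vec ℕ s → ℕ
wsum = wsumFrom 1

prodFact : ∀ {s} → Vec ℕ s → ℕ
prodFact [] = 1
prodFact (x ∷ t) = x ! * prodFact t

prodFact≢0 : ∀ {s} (t : Vec ℕ s) → NonZero (prodFact t)
prodFact≢0 [] = _
prodFact≢0 (x ∷ t) = m*n≢0 (x !) (prodFact t) {{x !≢0}} {{prodFact≢0 t}}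

multinomial : ∀ {s} → Vec ℕ s → ℕ
multinomial t = _/_ (total t !) (prodFact t) {{prodFact≢0 t}}

boxTuples : (s b : ℕ) → List (Vec ℕ s)
boxTuples zero b = [ [] ]
boxTuples (suc s) b = concatMap (λ x → map (x ∷_) (boxTuples s b)) (upTo (suc b))

-- all tuples (t₁,…,tₛ) of nonnegative integers with t₁ + 2t₂ + ⋯ + s tₛ = k
-- (each tᵢ ≤ k automatically, so searching the box {0,…,k}^s is exhaustive)
tuples : (s k : ℕ) → List (Vec ℕ s)
tuples s k = filter (λ t → wsum t ≟ k) (boxTuples s k)

-- the summand  (-1)^T k / T · multinomial(T; t),  T = t₁+⋯+tₛ
-- (T = 0 only for t = 0, which never occurs when k ≥ 1; value 0 there is irrelevant)
term : ∀ {s} → ℕ → Vec ℕ s → ℚ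
term k t with total t
... | zero = ℚ.0ℚ
... | suc T = ((-1ℤ ℤ.^ suc T) ℤ.* + (k * multinomial t)) ℚ./ suc T

sumℚ : List ℚ → ℚ
sumℚ = foldr ℚ._+_ ℚ.0ℚ

lhs : (s k : ℕ) → ℚ
lhs s k = sumℚ (map (term k) (tuples s k))

module Submission where

-- With T = t₁ + ⋯ + tₛ, M(t) the multinomial coefficient and e(t) = (−1)ᵀ M(t), the identity
-- tᵢ M(t) = T M(t − eᵢ) turns k = Σ i tᵢ into k e(t) / T = − Σᵢ i e(t − eᵢ).  Summing over the
-- tuples of weight k, the left-hand side becomes − Σᵢ₌₁ˢ i E(k − i), where E(m) = Σ_{weight m} e(t)
-- is the coefficient of xᵐ in Σ_T (−(x + ⋯ + xˢ))ᵀ = 1 / (1 + x + ⋯ + xˢ) = (1 − x) / (1 − xˢ⁺¹).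
-- So E(m) is 1, −1 or 0 according as m ≡ 0, m ≡ 1 or neither modulo s + 1, and the weighted sum
-- W(k) = Σᵢ i E(k − i) satisfies W(1) = 1 and W(k + 1) = W(k) − (s + 1) E(k − s), whence
-- W(k) = 1 − (s + 1) [s + 1 ∣ k].

open import Defs
open import Data.Nat using (ℕ; suc; _%_; NonZero)
open import Data.Integer using (+_; -1ℤ)
open import Data.Rational using (ℚ; _/_)
open import Data.Product using (_×_; _,_)
open import Relation.Binary.PropositionalEquality using (_≡_; _≢_)

open import Data.Empty using (⊥-elim)
open import Data.Fin as Fin using (Fin; toℕ)
open import Data.Fin.Properties using (toℕ<n)
open import Data.Integer as ℤ using (ℤ; 0ℤ; 1ℤ)
import Data.Integer.Properties as ℤP
open import Algebra.Properties.Semiring.Sum ℤP.+-*-semiring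
  using (sum-syntax; sum-cong-≗; sum-replicate-zero; ∑-distrib-+; *-distribˡ-sum; *-distribʳ-sum)
import Data.Integer.Tactic.RingSolver as ℤ-Solver
open import Data.List using (List; []; _∷_; _++_; map; filter; concatMap; applyUpTo; upTo; foldr)
open import Data.List.Properties using (map-∘; map-cong; map-cong-local; map-++)
import Data.List.Relation.Unary.All as All
open import Data.List.Relation.Unary.All.Properties using (all-filter)
open import Data.Nat using (zero; _+_; _*_; _∸_; _≤_; _<_; _≤?_; _≟_; _!; pred; z≤n; s≤s)
open import Data.Nat.Combinatorics.Specification using ([n∸k]!k!∣n!)
open import Data.Nat.Divisibility using (_∣_; ∣-refl; ∣-trans; *-monoʳ-∣)
open import Data.Nat.DivMod as DivMod using (m/n*n≡m; [m+n]%n≡m%n; m<n⇒m%n≡m)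
open import Data.Nat.Induction using (<-rec)
open import Data.Nat.Properties
import Data.Nat.Tactic.RingSolver as ℕ-Solver
import Data.Rational as ℚ
import Data.Rational.Properties as ℚP
import Data.Rational.Unnormalised as ℚᵘ
import Data.Rational.Unnormalised.Properties as ℚᵘP
open import Data.Vec using (Vec; []; _∷_; lookup; _[_]%=_; replicate)
open import Relation.Binary.PropositionalEquality using (refl; sym; trans; cong; cong₂; subst; module ≡-Reasoning)
open import Relation.Nullary using (Dec; yes; no; ¬_; contradiction)
open import Relation.Unary using (Pred; Decidable)

fromℤ : ℤ → ℚ
fromℤ z = z / 1

fromℤ-homo-+ : ∀ a b → fromℤ (a ℤ.+ b) ≡ fromℤ a ℚ.+ fromℤ b
fromℤ-homo-+ a b = begin
  fromℤ (a ℤ.+ b)                               ≡⟨ ℚP.fromℚᵘ-cong a+b≃ ⟩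
  ℚ.fromℚᵘ (ℚ.toℚᵘ (fromℤ a ℚ.+ fromℤ b))      ≡⟨ ℚP.fromℚᵘ-toℚᵘ (fromℤ a ℚ.+ fromℤ b) ⟩
  fromℤ a ℚ.+ fromℤ b                           ∎
  where
  open ≡-Reasoning
  unit-denominators : ∀ a b → (a ℤ.+ b) ℤ.* 1ℤ ≡ (a ℤ.* 1ℤ ℤ.+ b ℤ.* 1ℤ) ℤ.* 1ℤ
  unit-denominators = ℤ-Solver.solve-∀
  a+b≃ : ℚᵘ.mkℚᵘ (a ℤ.+ b) 0 ℚᵘ.≃ ℚ.toℚᵘ (fromℤ a ℚ.+ fromℤ b)
  a+b≃ = ℚᵘP.≃-trans (ℚᵘ.*≡* (unit-denominators a b))
           (ℚᵘP.≃-trans (ℚᵘP.+-cong (ℚᵘP.≃-sym (ℚP.toℚᵘ-fromℚᵘ (ℚᵘ.mkℚᵘ a 0)))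
                                    (ℚᵘP.≃-sym (ℚP.toℚᵘ-fromℚᵘ (ℚᵘ.mkℚᵘ b 0))))
             (ℚᵘP.≃-sym (ℚP.toℚᵘ-homo-+ (fromℤ a) (fromℤ b))))

[1+n]*z/[1+n]≡z : ∀ n z → (+ suc n ℤ.* z) / suc n ≡ fromℤ z
[1+n]*z/[1+n]≡z n z =
  ℚP.fromℚᵘ-cong {ℚᵘ.mkℚᵘ (+ suc n ℤ.* z) n} {ℚᵘ.mkℚᵘ z 0}
    (ℚᵘ.*≡* (trans (ℤP.*-identityʳ (+ suc n ℤ.* z)) (ℤP.*-comm (+ suc n) z)))

guard : ∀ {P : Set} → Dec P → ℤ → ℤ
guard (yes _) z = z
guard (no _)  _ = 0ℤ

guard-yes : ∀ {P : Set} (P? : Dec P) {z} → P → guard P? z ≡ z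
guard-yes (yes _) p = refl
guard-yes (no ¬p) p = ⊥-elim (¬p p)

guard-no : ∀ {P : Set} (P? : Dec P) {z} → ¬ P → guard P? z ≡ 0ℤ
guard-no (yes p) ¬p = ⊥-elim (¬p p)
guard-no (no _)  ¬p = refl

guard-cong : ∀ {P : Set} (P? : Dec P) {a b} → (P → a ≡ b) → guard P? a ≡ guard P? b
guard-cong (yes p) eq = eq p
guard-cong (no _)  eq = refl

guard-zero : ∀ {P : Set} (P? : Dec P) → guard P? 0ℤ ≡ 0ℤ
guard-zero (yes _) = refl
guard-zero (no _)  = refl

guard-+ : ∀ {P : Set} (P? : Dec P) a b → guard P? (a ℤ.+ b) ≡ guard P? a ℤ.+ guard P? b
guard-+ (yes _) a b = refl
guard-+ (no _)  a b = refl

guard-*ˡ : ∀ {P : Set} (P? : Dec P) c a → guard P? (c ℤ.* a) ≡ c ℤ.* guard P? a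
guard-*ˡ (yes _) c a = refl
guard-*ˡ (no _)  c a = sym (ℤP.*-zeroʳ c)

guard-⇔ : ∀ {P Q : Set} (P? : Dec P) (Q? : Dec Q) {z} → (P → Q) → (Q → P) → guard P? z ≡ guard Q? z
guard-⇔ (yes p) (yes q) f g = refl
guard-⇔ (yes p) (no ¬q) f g = ⊥-elim (¬q (f p))
guard-⇔ (no ¬p) (yes q) f g = ⊥-elim (¬p (g q))
guard-⇔ (no ¬p) (no ¬q) f g = refl

guard-s≤s : ∀ a b {z} → guard (suc a ≤? suc b) z ≡ guard (a ≤? b) z
guard-s≤s a b = guard-⇔ (suc a ≤? suc b) (a ≤? b) ≤-pred s≤s

guard-∸ : ∀ a b m (F : ℕ → ℤ) →
  guard (a + b ≤? m) (F (m ∸ (a + b))) ≡ guard (a ≤? m) (guard (b ≤? m ∸ a) (F (m ∸ a ∸ b)))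
guard-∸ a b m F with a ≤? m
... | yes a≤m = trans (guard-⇔ (a + b ≤? m) (b ≤? m ∸ a) a+b≤m⇒b≤m∸a b≤m∸a⇒a+b≤m)
                      (cong (guard (b ≤? m ∸ a)) (cong F (sym (∸-+-assoc m a b))))
  where
  a+b≤m⇒b≤m∸a : a + b ≤ m → b ≤ m ∸ a
  a+b≤m⇒b≤m∸a le = subst (_≤ m ∸ a) (m+n∸m≡n a b) (∸-monoˡ-≤ a le)
  b≤m∸a⇒a+b≤m : b ≤ m ∸ a → a + b ≤ m
  b≤m∸a⇒a+b≤m le = subst (a + b ≤_) (m+[n∸m]≡n a≤m) (+-monoʳ-≤ a le)
... | no a≰m = guard-no (a + b ≤? m) (λ le → a≰m (≤-trans (m≤m+n a b) le))

guard-swap : ∀ a b m (F : ℕ → ℤ) →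
  guard (a ≤? m) (guard (b ≤? m ∸ a) (F (m ∸ a ∸ b))) ≡ guard (b ≤? m) (guard (a ≤? m ∸ b) (F (m ∸ b ∸ a)))
guard-swap a b m F = begin
  guard (a ≤? m) (guard (b ≤? m ∸ a) (F (m ∸ a ∸ b)))   ≡⟨ guard-∸ a b m F ⟨
  guard (a + b ≤? m) (F (m ∸ (a + b)))                  ≡⟨ cong (λ n → guard (n ≤? m) (F (m ∸ n))) (+-comm a b) ⟩
  guard (b + a ≤? m) (F (m ∸ (b + a)))                  ≡⟨ guard-∸ b a m F ⟩
  guard (b ≤? m) (guard (a ≤? m ∸ b) (F (m ∸ b ∸ a)))   ∎
  where open ≡-Reasoning

guard-+≟ : ∀ a w k z → guard (a + w ≟ k) z ≡ guard (a ≤? k) (guard (w ≟ k ∸ a) z)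
guard-+≟ a w k z with a ≤? k
... | yes a≤k = guard-⇔ (a + w ≟ k) (w ≟ k ∸ a) (λ eq → trans (sym (m+n∸m≡n a w)) (cong (_∸ a) eq))
                        (λ eq → trans (cong (λ w → a + w) eq) (m+[n∸m]≡n a≤k))
... | no a≰k = guard-no (a + w ≟ k) (λ eq → a≰k (subst (a ≤_) eq (m≤m+n a w)))

∑-cong : ∀ {n} {f g : Fin n → ℤ} → (∀ i → f i ≡ g i) → ∑[ i < n ] f i ≡ ∑[ i < n ] g i
∑-cong = sum-cong-≗

∑-zero : ∀ n (h : ℕ → ℤ) → (∀ x → x < n → h x ≡ 0ℤ) → ∑[ i < n ] h (toℕ i) ≡ 0ℤ
∑-zero n h vanish = trans (sum-cong-≗ (λ i → vanish (toℕ i) (toℕ<n i))) (sum-replicate-zero n)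

∑-extend : ∀ n m (h : ℕ → ℤ) → n ≤ m → (∀ x → n ≤ x → x < m → h x ≡ 0ℤ) →
  ∑[ i < m ] h (toℕ i) ≡ ∑[ i < n ] h (toℕ i)
∑-extend zero    m       h z≤n       vanish = ∑-zero m h (λ x → vanish x z≤n)
∑-extend (suc n) (suc m) h (s≤s n≤m) vanish =
  cong (ℤ._+_ (h 0)) (∑-extend n m (λ x → h (suc x)) n≤m (λ x n≤x x<m → vanish (suc x) (s≤s n≤x) (s≤s x<m)))

∑-last : ∀ n (h : ℕ → ℤ) → ∑[ i < suc n ] h (toℕ i) ≡ ∑[ i < n ] h (toℕ i) ℤ.+ h n
∑-last zero    h = ℤP.+-comm (h 0) 0ℤ
∑-last (suc n) h = trans (cong (ℤ._+_ (h 0)) (∑-last n (λ x → h (suc x)))) (sym (ℤP.+-assoc (h 0) _ _))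

∑-guard : ∀ n {P : Set} (P? : Dec P) (h : Fin n → ℤ) → ∑[ i < n ] guard P? (h i) ≡ guard P? (∑[ i < n ] h i)
∑-guard n (yes _) h = refl
∑-guard n (no _)  h = sum-replicate-zero n

prodFact∣total! : ∀ {s} (t : Vec ℕ s) → prodFact t ∣ total t !
prodFact∣total! []      = ∣-refl
prodFact∣total! (x ∷ t) = ∣-trans (*-monoʳ-∣ (x !) (prodFact∣total! t))
  (subst (λ y → y ! * total t ! ∣ (x + total t) !) (m+n∸n≡m x (total t)) ([n∸k]!k!∣n! (m≤n+m (total t) x)))

multinomial*prodFact≡total! : ∀ {s} (t : Vec ℕ s) → multinomial t * prodFact t ≡ total t !
multinomial*prodFact≡total! t = m/n*n≡m {{prodFact≢0 t}} (prodFact∣total! t)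

total-pred : ∀ {s} (t : Vec ℕ s) i {n} → lookup t i ≡ suc n → total t ≡ suc (total (t [ i ]%= pred))
total-pred (x ∷ t) Fin.zero    refl = refl
total-pred (x ∷ t) (Fin.suc i) eq   = trans (cong (_+_ x) (total-pred t i eq)) (+-suc x _)

prodFact-pred : ∀ {s} (t : Vec ℕ s) i {n} → lookup t i ≡ suc n →
  prodFact t ≡ lookup t i * prodFact (t [ i ]%= pred)
prodFact-pred (x ∷ t) Fin.zero {n} refl = *-assoc (suc n) (n !) (prodFact t)
prodFact-pred (x ∷ t) (Fin.suc i) eq =
  trans (cong (x ! *_) (prodFact-pred t i eq)) (x*[y*z]≡y*[x*z] (x !) (lookup t i) _)
  where x*[y*z]≡y*[x*z] : ∀ a b c → a * (b * c) ≡ b * (a * c)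
        x*[y*z]≡y*[x*z] = ℕ-Solver.solve-∀

multinomial-pred : ∀ {s} (t : Vec ℕ s) i {n} → lookup t i ≡ suc n →
  lookup t i * multinomial t ≡ total t * multinomial (t [ i ]%= pred)
multinomial-pred t i eq = *-cancelʳ-≡ _ _ (prodFact t′) {{prodFact≢0 t′}} (begin
  lookup t i * multinomial t * prodFact t′
    ≡⟨ x*y*z≡y*[x*z] (lookup t i) (multinomial t) _ ⟩
  multinomial t * (lookup t i * prodFact t′)
    ≡⟨ cong (multinomial t *_) (prodFact-pred t i eq) ⟨
  multinomial t * prodFact t
    ≡⟨ multinomial*prodFact≡total! t ⟩
  total t !
    ≡⟨ cong _! (total-pred t i eq) ⟩
  suc (total t′) * total t′ !
    ≡⟨ cong (suc (total t′) *_) (multinomial*prodFact≡total! t′) ⟨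
  suc (total t′) * (multinomial t′ * prodFact t′)
    ≡⟨ *-assoc (suc (total t′)) (multinomial t′) (prodFact t′) ⟨
  suc (total t′) * multinomial t′ * prodFact t′
    ≡⟨ cong (λ T → T * multinomial t′ * prodFact t′) (total-pred t i eq) ⟨
  total t * multinomial t′ * prodFact t′
    ∎)
  where
  open ≡-Reasoning
  t′ = t [ i ]%= pred
  x*y*z≡y*[x*z] : ∀ a b c → a * b * c ≡ b * (a * c)
  x*y*z≡y*[x*z] = ℕ-Solver.solve-∀

signedMultinomial : ∀ {s} → Vec ℕ s → ℤ
signedMultinomial t = -1ℤ ℤ.^ total t ℤ.* + multinomial t

whenPositive : ℕ → ℤ → ℤ
whenPositive zero    _ = 0ℤ
whenPositive (suc _) z = z

lowerAt : ∀ {s} → (Vec ℕ s → ℤ) → Fin s → Vec ℕ s → ℤ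
lowerAt f i t = whenPositive (lookup t i) (f (t [ i ]%= pred))

lookup*signedMultinomial : ∀ {s} (t : Vec ℕ s) i →
  + lookup t i ℤ.* signedMultinomial t ≡ ℤ.- (+ total t ℤ.* lowerAt signedMultinomial i t)
lookup*signedMultinomial t i with lookup t i in eq
... | zero  = trans (ℤP.*-zeroˡ (signedMultinomial t)) (cong ℤ.-_ (sym (ℤP.*-zeroʳ (+ total t))))
... | suc n = begin
  + suc n ℤ.* (-1ℤ ℤ.^ total t ℤ.* + M)   ≡⟨ cong (λ T → + suc n ℤ.* (-1ℤ ℤ.^ T ℤ.* + M)) (total-pred t i eq) ⟩
  + suc n ℤ.* (-1ℤ ℤ.* u ℤ.* + M)         ≡⟨ pull-sign (+ suc n) u (+ M) ⟩
  ℤ.- (u ℤ.* (+ suc n ℤ.* + M))           ≡⟨ cong (λ z → ℤ.- (u ℤ.* z)) multinomial-predᶻ ⟩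
  ℤ.- (u ℤ.* (+ total t ℤ.* + M′))        ≡⟨ cong ℤ.-_ (x*[y*z]≡y*[x*z] u (+ total t) (+ M′)) ⟩
  ℤ.- (+ total t ℤ.* (u ℤ.* + M′))        ∎
  where
  open ≡-Reasoning
  t′ = t [ i ]%= pred
  u  = -1ℤ ℤ.^ total t′
  M  = multinomial t
  M′ = multinomial t′
  multinomial-predᶻ : + suc n ℤ.* + M ≡ + total t ℤ.* + M′
  multinomial-predᶻ = begin
    + suc n ℤ.* + M      ≡⟨ ℤP.pos-* (suc n) M ⟨
    + (suc n * M)        ≡⟨ cong (λ a → + (a * M)) eq ⟨
    + (lookup t i * M)   ≡⟨ cong (λ a → + a) (multinomial-pred t i eq) ⟩
    + (total t * M′)     ≡⟨ ℤP.pos-* (total t) M′ ⟩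
    + total t ℤ.* + M′   ∎
  pull-sign : ∀ a u m → a ℤ.* (-1ℤ ℤ.* u ℤ.* m) ≡ ℤ.- (u ℤ.* (a ℤ.* m))
  pull-sign = ℤ-Solver.solve-∀
  x*[y*z]≡y*[x*z] : ∀ a b c → a ℤ.* (b ℤ.* c) ≡ b ℤ.* (a ℤ.* c)
  x*[y*z]≡y*[x*z] = ℤ-Solver.solve-∀

∑-lookup≡total : ∀ {s} (t : Vec ℕ s) → ∑[ i < s ] (1ℤ ℤ.* + lookup t i) ≡ + total t
∑-lookup≡total []      = refl
∑-lookup≡total (x ∷ t) =
  trans (cong₂ ℤ._+_ (ℤP.*-identityˡ (+ x)) (∑-lookup≡total t)) (sym (ℤP.pos-+ x (total t)))

∑-weight*lookup≡wsumFrom : ∀ {s} off (t : Vec ℕ s) →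
  ∑[ i < s ] (+ (off + toℕ i) ℤ.* + lookup t i) ≡ + wsumFrom off t
∑-weight*lookup≡wsumFrom off []      = refl
∑-weight*lookup≡wsumFrom off (x ∷ t) = trans (cong₂ ℤ._+_ head tail) (sym (ℤP.pos-+ (off * x) _))
  where
  head : + (off + 0) ℤ.* + x ≡ + (off * x)
  head = trans (cong (λ w → + w ℤ.* + x) (+-identityʳ off)) (sym (ℤP.pos-* off x))
  tail : ∑[ i < _ ] (+ (off + suc (toℕ i)) ℤ.* + lookup t i) ≡ + wsumFrom (suc off) t
  tail = trans (sum-cong-≗ (λ i → cong (λ w → + w ℤ.* + lookup t i) (+-suc off (toℕ i))))
               (∑-weight*lookup≡wsumFrom (suc off) t)

∑-weighted-signedMultinomial : ∀ {s} (c : Fin s → ℤ) (t : Vec ℕ s) →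
  (∑[ i < s ] (c i ℤ.* + lookup t i)) ℤ.* signedMultinomial t
    ≡ ℤ.- (+ total t ℤ.* ∑[ i < s ] (c i ℤ.* lowerAt signedMultinomial i t))
∑-weighted-signedMultinomial {s} c t = begin
  (∑[ i < s ] (c i ℤ.* + lookup t i)) ℤ.* σ          ≡⟨ *-distribʳ-sum σ (λ i → c i ℤ.* + lookup t i) ⟩
  ∑[ i < s ] (c i ℤ.* + lookup t i ℤ.* σ)           ≡⟨ sum-cong-≗ pointwise ⟩
  ∑[ i < s ] (ℤ.- (+ total t) ℤ.* (c i ℤ.* ℓ i))    ≡⟨ *-distribˡ-sum (ℤ.- (+ total t)) (λ i → c i ℤ.* ℓ i) ⟨
  ℤ.- (+ total t) ℤ.* ∑[ i < s ] (c i ℤ.* ℓ i)      ≡⟨ ℤP.neg-distribˡ-* (+ total t) _ ⟨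
  ℤ.- (+ total t ℤ.* ∑[ i < s ] (c i ℤ.* ℓ i))       ∎
  where
  open ≡-Reasoning
  σ = signedMultinomial t
  ℓ : Fin s → ℤ
  ℓ i = lowerAt signedMultinomial i t
  rearrange : ∀ c x σ T ℓ → x ℤ.* σ ≡ ℤ.- (T ℤ.* ℓ) → c ℤ.* x ℤ.* σ ≡ ℤ.- T ℤ.* (c ℤ.* ℓ)
  rearrange c x σ T ℓ eq = trans (ℤP.*-assoc c x σ) (trans (cong (c ℤ.*_) eq) (move c T ℓ))
    where move : ∀ c T ℓ → c ℤ.* ℤ.- (T ℤ.* ℓ) ≡ ℤ.- T ℤ.* (c ℤ.* ℓ)
          move = ℤ-Solver.solve-∀
  pointwise : ∀ i → c i ℤ.* + lookup t i ℤ.* σ ≡ ℤ.- (+ total t) ℤ.* (c i ℤ.* ℓ i)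
  pointwise i = rearrange (c i) (+ lookup t i) σ (+ total t) (ℓ i) (lookup*signedMultinomial t i)

signedMultinomial-rec : ∀ {s} (t : Vec ℕ s) {T} → total t ≡ suc T →
  signedMultinomial t ≡ ℤ.- ∑[ i < s ] (1ℤ ℤ.* lowerAt signedMultinomial i t)
signedMultinomial-rec {s} t {T} eqT =
  ℤP.*-cancelˡ-≡ (+ suc T) _ _ (subst (λ n → + n ℤ.* signedMultinomial t ≡ + n ℤ.* ℤ.- S) eqT (begin
  + total t ℤ.* signedMultinomial t                          ≡⟨ cong (ℤ._* signedMultinomial t) (∑-lookup≡total t) ⟨
  (∑[ i < s ] (1ℤ ℤ.* + lookup t i)) ℤ.* signedMultinomial t   ≡⟨ ∑-weighted-signedMultinomial (λ _ → 1ℤ) t ⟩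
  ℤ.- (+ total t ℤ.* S)                                      ≡⟨ ℤP.neg-distribʳ-* (+ total t) S ⟩
  + total t ℤ.* ℤ.- S                                        ∎))
  where
  open ≡-Reasoning
  S = ∑[ i < s ] (1ℤ ℤ.* lowerAt signedMultinomial i t)

-- The with-abstraction also rewrites the total t hidden in multinomial t = (total t)! / prodFact t;
-- eq puts it back.
term-unfold : ∀ k {s} (t : Vec ℕ s) {T} → total t ≡ suc T →
  term k t ≡ (-1ℤ ℤ.^ suc T ℤ.* + (k * multinomial t)) / suc T
term-unfold k t {T} eqT with total t in eq | eqT
... | .(suc T) | refl =
  cong (λ n → (-1ℤ ℤ.^ suc T ℤ.* + (k * DivMod._/_ (n !) (prodFact t) {{prodFact≢0 t}})) / suc T) eq

term≡-∑lowerAt : ∀ {s} k (t : Vec ℕ s) {T} → total t ≡ suc T → wsum t ≡ k →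
  term k t ≡ fromℤ (ℤ.- ∑[ i < s ] (+ suc (toℕ i) ℤ.* lowerAt signedMultinomial i t))
term≡-∑lowerAt {s} k t {T} eqT eqk = begin
  term k t                                                  ≡⟨ term-unfold k t eqT ⟩
  (-1ℤ ℤ.^ suc T ℤ.* + (k * multinomial t)) / suc T         ≡⟨ cong (_/ suc T) numerator ⟩
  (+ suc T ℤ.* ℤ.- S) / suc T                               ≡⟨ [1+n]*z/[1+n]≡z T (ℤ.- S) ⟩
  fromℤ (ℤ.- S)                                             ∎
  where
  open ≡-Reasoning
  S = ∑[ i < s ] (+ suc (toℕ i) ℤ.* lowerAt signedMultinomial i t)
  x*[y*z]≡y*[x*z] : ∀ a b c → a ℤ.* (b ℤ.* c) ≡ b ℤ.* (a ℤ.* c)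
  x*[y*z]≡y*[x*z] = ℤ-Solver.solve-∀
  numerator : -1ℤ ℤ.^ suc T ℤ.* + (k * multinomial t) ≡ + suc T ℤ.* ℤ.- S
  numerator = begin
    -1ℤ ℤ.^ suc T ℤ.* + (k * multinomial t)
      ≡⟨ cong (-1ℤ ℤ.^ suc T ℤ.*_) (ℤP.pos-* k (multinomial t)) ⟩
    -1ℤ ℤ.^ suc T ℤ.* (+ k ℤ.* + multinomial t)
      ≡⟨ x*[y*z]≡y*[x*z] (-1ℤ ℤ.^ suc T) (+ k) _ ⟩
    + k ℤ.* (-1ℤ ℤ.^ suc T ℤ.* + multinomial t)
      ≡⟨ cong (λ n → + k ℤ.* (-1ℤ ℤ.^ n ℤ.* + multinomial t)) eqT ⟨
    + k ℤ.* signedMultinomial t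
      ≡⟨ cong (λ n → + n ℤ.* signedMultinomial t) eqk ⟨
    + wsum t ℤ.* signedMultinomial t
      ≡⟨ cong (ℤ._* signedMultinomial t) (∑-weight*lookup≡wsumFrom 1 t) ⟨
    (∑[ i < s ] (+ suc (toℕ i) ℤ.* + lookup t i)) ℤ.* signedMultinomial t
      ≡⟨ ∑-weighted-signedMultinomial (λ i → + suc (toℕ i)) t ⟩
    ℤ.- (+ total t ℤ.* S)
      ≡⟨ ℤP.neg-distribʳ-* (+ total t) S ⟩
    + total t ℤ.* ℤ.- S
      ≡⟨ cong (λ n → + n ℤ.* ℤ.- S) eqT ⟩
    + suc T ℤ.* ℤ.- S
      ∎

total-replicate-0 : ∀ s → total (replicate s 0) ≡ 0
total-replicate-0 zero    = refl
total-replicate-0 (suc s) = total-replicate-0 s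

prodFact-replicate-0 : ∀ s → prodFact (replicate s 0) ≡ 1
prodFact-replicate-0 zero    = refl
prodFact-replicate-0 (suc s) = trans (+-identityʳ _) (prodFact-replicate-0 s)

signedMultinomial-replicate-0 : ∀ s → signedMultinomial (replicate s 0) ≡ 1ℤ
signedMultinomial-replicate-0 s =
  cong₂ (λ T M → -1ℤ ℤ.^ T ℤ.* + M) (total-replicate-0 s) multinomial-replicate-0
  where
  open ≡-Reasoning
  z = replicate s 0
  multinomial-replicate-0 : multinomial z ≡ 1
  multinomial-replicate-0 = begin
    multinomial z              ≡⟨ *-identityʳ _ ⟨
    multinomial z * 1          ≡⟨ cong (multinomial z *_) (prodFact-replicate-0 s) ⟨
    multinomial z * prodFact z ≡⟨ multinomial*prodFact≡total! z ⟩
    total z !                  ≡⟨ cong _! (total-replicate-0 s) ⟩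
    1                          ∎

total≡0⇒wsumFrom≡0 : ∀ {s} off (t : Vec ℕ s) → total t ≡ 0 → wsumFrom off t ≡ 0
total≡0⇒wsumFrom≡0 off []      _  = refl
total≡0⇒wsumFrom≡0 off (x ∷ t) eq = cong₂ _+_ (trans (cong (off *_) (m+n≡0⇒m≡0 x eq)) (*-zeroʳ off))
                                              (total≡0⇒wsumFrom≡0 (suc off) t (m+n≡0⇒n≡0 x eq))

total-positive : ∀ {s} off (t : Vec ℕ s) {m} → wsumFrom off t ≡ suc m → total t ≡ suc (pred (total t))
total-positive off t eq with total t in eqT
... | zero  = contradiction (trans (sym eq) (total≡0⇒wsumFrom≡0 off t eqT)) λ ()
... | suc _ = refl

-- For off ≥ 1, levelSum off s k f is the sum of f over all t with wsumFrom off t ≡ k,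
-- and headSlice off s k f x is the part of it with head x.
levelSum : (off s k : ℕ) → (Vec ℕ s → ℤ) → ℤ
headSlice : (off s k : ℕ) → (Vec ℕ (suc s) → ℤ) → ℕ → ℤ

levelSum off zero    zero    f = f []
levelSum off zero    (suc k) f = 0ℤ
levelSum off (suc s) k       f = ∑[ x < suc k ] headSlice off s k f (toℕ x)

headSlice off s k f x = guard (off * x ≤? k) (levelSum (suc off) s (k ∸ off * x) (λ t → f (x ∷ t)))

levelSum-cong : ∀ off s k {f g : Vec ℕ s → ℤ} → (∀ t → wsumFrom off t ≡ k → f t ≡ g t) →
  levelSum off s k f ≡ levelSum off s k g
levelSum-cong off zero    zero    f≗g = f≗g [] refl
levelSum-cong off zero    (suc k) f≗g = refl
levelSum-cong off (suc s) k {f} {g} f≗g = ∑-cong {suc k} λ x → slice (toℕ x)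
  where
  slice : ∀ x → headSlice off s k f x ≡ headSlice off s k g x
  slice x = guard-cong (off * x ≤? k) λ le → levelSum-cong (suc off) s (k ∸ off * x)
    λ t eq → f≗g (x ∷ t) (trans (cong (_+_ (off * x)) eq) (m+[n∸m]≡n le))

levelSum-+ : ∀ off s k (f g : Vec ℕ s → ℤ) →
  levelSum off s k (λ t → f t ℤ.+ g t) ≡ levelSum off s k f ℤ.+ levelSum off s k g
levelSum-+ off zero    zero    f g = refl
levelSum-+ off zero    (suc k) f g = refl
levelSum-+ off (suc s) k       f g = trans (∑-cong {suc k} λ x → split (toℕ x))
  (∑-distrib-+ {suc k} (λ x → headSlice off s k f (toℕ x)) (λ x → headSlice off s k g (toℕ x)))
  where
  split : ∀ x → headSlice off s k (λ t → f t ℤ.+ g t) x ≡ headSlice off s k f x ℤ.+ headSlice off s k g x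
  split x = trans (cong (guard (off * x ≤? k)) (levelSum-+ (suc off) s _ (λ t → f (x ∷ t)) (λ t → g (x ∷ t))))
                  (guard-+ (off * x ≤? k) _ _)

levelSum-*ˡ : ∀ off s k c (f : Vec ℕ s → ℤ) → levelSum off s k (λ t → c ℤ.* f t) ≡ c ℤ.* levelSum off s k f
levelSum-*ˡ off zero    zero    c f = refl
levelSum-*ˡ off zero    (suc k) c f = sym (ℤP.*-zeroʳ c)
levelSum-*ˡ off (suc s) k       c f = trans (∑-cong {suc k} λ x → pull (toℕ x))
  (sym (*-distribˡ-sum {suc k} c (λ x → headSlice off s k f (toℕ x))))
  where
  pull : ∀ x → headSlice off s k (λ t → c ℤ.* f t) x ≡ c ℤ.* headSlice off s k f x
  pull x = trans (cong (guard (off * x ≤? k)) (levelSum-*ˡ (suc off) s _ c (λ t → f (x ∷ t))))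
                 (guard-*ˡ (off * x ≤? k) c _)

levelSum-0 : ∀ off s k → levelSum off s k (λ _ → 0ℤ) ≡ 0ℤ
levelSum-0 off s k = levelSum-*ˡ off s k 0ℤ (λ _ → 0ℤ)

levelSum-neg : ∀ off s k (f : Vec ℕ s → ℤ) → levelSum off s k (λ t → ℤ.- f t) ≡ ℤ.- levelSum off s k f
levelSum-neg off s k f = begin
  levelSum off s k (λ t → ℤ.- f t)     ≡⟨ levelSum-cong off s k (λ t _ → sym (ℤP.-1*i≡-i (f t))) ⟩
  levelSum off s k (λ t → -1ℤ ℤ.* f t) ≡⟨ levelSum-*ˡ off s k -1ℤ f ⟩
  -1ℤ ℤ.* levelSum off s k f           ≡⟨ ℤP.-1*i≡-i _ ⟩
  ℤ.- levelSum off s k f               ∎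
  where open ≡-Reasoning

levelSum-∑ : ∀ off s k {r} (h : Fin r → Vec ℕ s → ℤ) →
  levelSum off s k (λ t → ∑[ i < r ] h i t) ≡ ∑[ i < r ] levelSum off s k (h i)
levelSum-∑ off s k {zero}  h = levelSum-0 off s k
levelSum-∑ off s k {suc r} h = trans (levelSum-+ off s k (h Fin.zero) (λ t → ∑[ i < r ] h (Fin.suc i) t))
  (cong (ℤ._+_ (levelSum off s k (h Fin.zero))) (levelSum-∑ off s k (λ i → h (Fin.suc i))))

∑-headSlice≡levelSum : ∀ o s r n (f : Vec ℕ (suc s) → ℤ) → r < n →
  ∑[ x < n ] headSlice (suc o) s r f (toℕ x) ≡ levelSum (suc o) (suc s) r f
∑-headSlice≡levelSum o s r n f r<n = ∑-extend (suc r) n (headSlice (suc o) s r f) r<n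
  (λ x r<x _ → guard-no (suc o * x ≤? r) (<⇒≱ (≤-trans r<x (m≤n*m x (suc o)))))

levelSum-lowerAt-zero : ∀ o s m (g : Vec ℕ (suc s) → ℤ) →
  levelSum (suc o) (suc s) m (lowerAt g Fin.zero) ≡ guard (suc o ≤? m) (levelSum (suc o) (suc s) (m ∸ suc o) g)
levelSum-lowerAt-zero o s m g = begin
  levelSum (suc o) (suc s) m (lowerAt g Fin.zero)
    ≡⟨ cong (ℤ._+ ∑[ y < m ] slice (suc (toℕ y))) head-vanishes ⟩
  0ℤ ℤ.+ ∑[ y < m ] slice (suc (toℕ y))
    ≡⟨ ℤP.+-identityˡ _ ⟩
  ∑[ y < m ] slice (suc (toℕ y))
    ≡⟨ ∑-cong {m} (λ y → slice-suc (toℕ y)) ⟩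
  ∑[ y < m ] guard (suc o ≤? m) (headSlice (suc o) s (m ∸ suc o) g (toℕ y))
    ≡⟨ ∑-guard m (suc o ≤? m) (λ y → headSlice (suc o) s (m ∸ suc o) g (toℕ y)) ⟩
  guard (suc o ≤? m) (∑[ y < m ] headSlice (suc o) s (m ∸ suc o) g (toℕ y))
    ≡⟨ guard-cong (suc o ≤? m) (λ o<m → ∑-headSlice≡levelSum o s (m ∸ suc o) m g (∸-monoʳ-< (s≤s z≤n) o<m)) ⟩
  guard (suc o ≤? m) (levelSum (suc o) (suc s) (m ∸ suc o) g)
    ∎
  where
  open ≡-Reasoning
  slice = headSlice (suc o) s m (lowerAt g Fin.zero)
  head-vanishes : slice 0 ≡ 0ℤ
  head-vanishes = trans (cong (guard (suc o * 0 ≤? m)) (levelSum-0 (suc (suc o)) s _)) (guard-zero (suc o * 0 ≤? m))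
  slice-suc : ∀ y → slice (suc y) ≡ guard (suc o ≤? m) (headSlice (suc o) s (m ∸ suc o) g y)
  slice-suc y = trans (cong (λ n → guard (n ≤? m) (F (m ∸ n))) (*-suc (suc o) y)) (guard-∸ (suc o) (suc o * y) m F)
    where F : ℕ → ℤ
          F r = levelSum (suc (suc o)) s r (λ t → g (y ∷ t))

levelSum-lowerAt : ∀ o s (i : Fin s) m (g : Vec ℕ s → ℤ) →
  levelSum (suc o) s m (lowerAt g i) ≡ guard (suc o + toℕ i ≤? m) (levelSum (suc o) s (m ∸ (suc o + toℕ i)) g)
levelSum-lowerAt o (suc s) Fin.zero m g = trans (levelSum-lowerAt-zero o s m g)
  (cong (λ w → guard (w ≤? m) (levelSum (suc o) (suc s) (m ∸ w) g)) (sym (+-identityʳ (suc o))))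
levelSum-lowerAt o (suc s) (Fin.suc j) m g = begin
  levelSum (suc o) (suc s) m (lowerAt g (Fin.suc j))
    ≡⟨ ∑-cong {suc m} (λ x → slice-lower (toℕ x)) ⟩
  ∑[ x < suc m ] guard (w ≤? m) (headSlice (suc o) s (m ∸ w) g (toℕ x))
    ≡⟨ ∑-guard (suc m) (w ≤? m) (λ x → headSlice (suc o) s (m ∸ w) g (toℕ x)) ⟩
  guard (w ≤? m) (∑[ x < suc m ] headSlice (suc o) s (m ∸ w) g (toℕ x))
    ≡⟨ cong (guard (w ≤? m)) (∑-headSlice≡levelSum o s (m ∸ w) (suc m) g (s≤s (m∸n≤m m w))) ⟩
  guard (w ≤? m) (levelSum (suc o) (suc s) (m ∸ w) g)
    ≡⟨ cong (λ w → guard (w ≤? m) (levelSum (suc o) (suc s) (m ∸ w) g)) (+-suc (suc o) (toℕ j)) ⟨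
  guard (suc o + suc (toℕ j) ≤? m) (levelSum (suc o) (suc s) (m ∸ (suc o + suc (toℕ j))) g)
    ∎
  where
  open ≡-Reasoning
  w = suc (suc o) + toℕ j
  slice-lower : ∀ x → headSlice (suc o) s m (lowerAt g (Fin.suc j)) x ≡ guard (w ≤? m) (headSlice (suc o) s (m ∸ w) g x)
  slice-lower x = trans (cong (guard (suc o * x ≤? m)) (levelSum-lowerAt (suc o) s j (m ∸ suc o * x) (λ t → g (x ∷ t))))
                        (guard-swap (suc o * x) w m (λ r → levelSum (suc (suc o)) s r (λ t → g (x ∷ t))))

levelSum-level-0 : ∀ off s (f : Vec ℕ s → ℤ) → levelSum off s 0 f ≡ f (replicate s 0)
levelSum-level-0 off zero    f = refl
levelSum-level-0 off (suc s) f rewrite *-zeroʳ off =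
  trans (ℤP.+-identityʳ _) (levelSum-level-0 (suc off) s (λ t → f (0 ∷ t)))

sumℤ : List ℤ → ℤ
sumℤ = foldr ℤ._+_ 0ℤ

sumℤ-++ : ∀ xs ys → sumℤ (xs ++ ys) ≡ sumℤ xs ℤ.+ sumℤ ys
sumℤ-++ []       ys = sym (ℤP.+-identityˡ _)
sumℤ-++ (x ∷ xs) ys = trans (cong (ℤ._+_ x) (sumℤ-++ xs ys)) (sym (ℤP.+-assoc x _ _))

sumℤ-concatMap : ∀ {A B : Set} (h : B → ℤ) (F : A → List B) xs →
  sumℤ (map h (concatMap F xs)) ≡ sumℤ (map (λ x → sumℤ (map h (F x))) xs)
sumℤ-concatMap h F []       = refl
sumℤ-concatMap h F (x ∷ xs) = begin
  sumℤ (map h (F x ++ concatMap F xs))               ≡⟨ cong sumℤ (map-++ h (F x) _) ⟩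
  sumℤ (map h (F x) ++ map h (concatMap F xs))       ≡⟨ sumℤ-++ (map h (F x)) _ ⟩
  sumℤ (map h (F x)) ℤ.+ sumℤ (map h (concatMap F xs)) ≡⟨ cong (ℤ._+_ (sumℤ (map h (F x)))) (sumℤ-concatMap h F xs) ⟩
  sumℤ (map h (F x)) ℤ.+ sumℤ (map (λ x → sumℤ (map h (F x))) xs) ∎
  where open ≡-Reasoning

sumℤ-applyUpTo : ∀ (g : ℕ → ℤ) (f : ℕ → ℕ) n → sumℤ (map g (applyUpTo f n)) ≡ ∑[ x < n ] g (f (toℕ x))
sumℤ-applyUpTo g f zero    = refl
sumℤ-applyUpTo g f (suc n) = cong (ℤ._+_ (g (f 0))) (sumℤ-applyUpTo g (λ x → f (suc x)) n)

sumℤ-guard : ∀ {A : Set} {P : Set} (P? : Dec P) (g : A → ℤ) xs →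
  sumℤ (map (λ x → guard P? (g x)) xs) ≡ guard P? (sumℤ (map g xs))
sumℤ-guard (yes _) g xs       = refl
sumℤ-guard (no _)  g []       = refl
sumℤ-guard (no ¬p) g (x ∷ xs) = trans (ℤP.+-identityˡ _) (sumℤ-guard (no ¬p) g xs)

sumℤ-filter : ∀ {A : Set} {P : Pred A _} (P? : Decidable P) (f : A → ℤ) xs →
  sumℤ (map f (filter P? xs)) ≡ sumℤ (map (λ x → guard (P? x) (f x)) xs)
sumℤ-filter P? f []       = refl
sumℤ-filter P? f (x ∷ xs) with P? x
... | yes _ = cong (ℤ._+_ (f x)) (sumℤ-filter P? f xs)
... | no _  = trans (sumℤ-filter P? f xs) (sym (ℤP.+-identityˡ _))

sumℤ-boxTuples-suc : ∀ s b (h : Vec ℕ (suc s) → ℤ) →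
  sumℤ (map h (boxTuples (suc s) b)) ≡ ∑[ x < suc b ] sumℤ (map (λ t → h (toℕ x ∷ t)) (boxTuples s b))
sumℤ-boxTuples-suc s b h =
  trans (sumℤ-concatMap h (λ x → map (x ∷_) (boxTuples s b)) (upTo (suc b)))
    (trans (sumℤ-applyUpTo (λ x → sumℤ (map h (map (x ∷_) (boxTuples s b)))) (λ x → x) (suc b))
      (∑-cong {suc b} (λ x → cong sumℤ (sym (map-∘ {g = h} {f = toℕ x ∷_} (boxTuples s b))))))

sumℤ-boxTuples≡levelSum : ∀ o s b k (f : Vec ℕ s → ℤ) → k ≤ b →
  sumℤ (map (λ t → guard (wsumFrom (suc o) t ≟ k) (f t)) (boxTuples s b)) ≡ levelSum (suc o) s k f
sumℤ-boxTuples≡levelSum o zero    b zero    f _   = ℤP.+-identityʳ (f [])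
sumℤ-boxTuples≡levelSum o zero    b (suc k) f _   = refl
sumℤ-boxTuples≡levelSum o (suc s) b k       f k≤b =
  trans (sumℤ-boxTuples-suc s b _)
    (trans (∑-cong {suc b} (λ x → slice (toℕ x))) (∑-headSlice≡levelSum o s k (suc b) f (s≤s k≤b)))
  where
  w = wsumFrom (suc (suc o))
  slice : ∀ x → sumℤ (map (λ t → guard (suc o * x + w t ≟ k) (f (x ∷ t))) (boxTuples s b))
                ≡ headSlice (suc o) s k f x
  slice x = begin
    sumℤ (map (λ t → guard (suc o * x + w t ≟ k) (f (x ∷ t))) (boxTuples s b))
      ≡⟨ cong sumℤ (map-cong (λ t → guard-+≟ (suc o * x) (w t) k (f (x ∷ t))) (boxTuples s b)) ⟩
    sumℤ (map (λ t → guard (suc o * x ≤? k) (guard (w t ≟ k ∸ suc o * x) (f (x ∷ t)))) (boxTuples s b))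
      ≡⟨ sumℤ-guard (suc o * x ≤? k) (λ t → guard (w t ≟ k ∸ suc o * x) (f (x ∷ t))) (boxTuples s b) ⟩
    guard (suc o * x ≤? k) (sumℤ (map (λ t → guard (w t ≟ k ∸ suc o * x) (f (x ∷ t))) (boxTuples s b)))
      ≡⟨ cong (guard (suc o * x ≤? k))
           (sumℤ-boxTuples≡levelSum (suc o) s b (k ∸ suc o * x) (λ t → f (x ∷ t)) (≤-trans (m∸n≤m k (suc o * x)) k≤b)) ⟩
    headSlice (suc o) s k f x ∎
    where open ≡-Reasoning

sumℚ-map-fromℤ : ∀ (xs : List ℤ) → sumℚ (map fromℤ xs) ≡ fromℤ (sumℤ xs)
sumℚ-map-fromℤ []       = refl
sumℚ-map-fromℤ (x ∷ xs) = trans (cong (fromℤ x ℚ.+_) (sumℚ-map-fromℤ xs)) (sym (fromℤ-homo-+ x (sumℤ xs)))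

-- The coefficient of xᵐ in 1 / (1 + x + ⋯ + xˢ) = Σ_T (−(x + ⋯ + xˢ))ᵀ.
reciprocalCoeff : ℕ → ℕ → ℤ
reciprocalCoeff s m = levelSum 1 s m signedMultinomial

levelSum-∑lowerAt : ∀ s m (c : Fin s → ℤ) →
  levelSum 1 s (suc m) (λ t → ℤ.- ∑[ i < s ] (c i ℤ.* lowerAt signedMultinomial i t))
    ≡ ℤ.- ∑[ i < s ] (c i ℤ.* guard (toℕ i ≤? m) (reciprocalCoeff s (m ∸ toℕ i)))
levelSum-∑lowerAt s m c = begin
  levelSum 1 s (suc m) (λ t → ℤ.- ∑[ i < s ] (c i ℤ.* lowerAt signedMultinomial i t))
    ≡⟨ levelSum-neg 1 s (suc m) _ ⟩
  ℤ.- levelSum 1 s (suc m) (λ t → ∑[ i < s ] (c i ℤ.* lowerAt signedMultinomial i t))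
    ≡⟨ cong ℤ.-_ (levelSum-∑ 1 s (suc m) (λ i t → c i ℤ.* lowerAt signedMultinomial i t)) ⟩
  ℤ.- ∑[ i < s ] levelSum 1 s (suc m) (λ t → c i ℤ.* lowerAt signedMultinomial i t)
    ≡⟨ cong ℤ.-_ (∑-cong {s} lowered) ⟩
  ℤ.- ∑[ i < s ] (c i ℤ.* guard (toℕ i ≤? m) (reciprocalCoeff s (m ∸ toℕ i)))
    ∎
  where
  open ≡-Reasoning
  lowered : ∀ i → levelSum 1 s (suc m) (λ t → c i ℤ.* lowerAt signedMultinomial i t)
                  ≡ c i ℤ.* guard (toℕ i ≤? m) (reciprocalCoeff s (m ∸ toℕ i))
  lowered i = trans (levelSum-*ˡ 1 s (suc m) (c i) (lowerAt signedMultinomial i))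
    (cong (c i ℤ.*_) (trans (levelSum-lowerAt 0 s i (suc m) signedMultinomial) (guard-s≤s (toℕ i) m)))

reciprocalCoeff-0 : ∀ s → reciprocalCoeff s 0 ≡ 1ℤ
reciprocalCoeff-0 s = trans (levelSum-level-0 1 s signedMultinomial) (signedMultinomial-replicate-0 s)

reciprocalCoeff-suc : ∀ s m →
  reciprocalCoeff s (suc m) ≡ ℤ.- ∑[ j < s ] guard (toℕ j ≤? m) (reciprocalCoeff s (m ∸ toℕ j))
reciprocalCoeff-suc s m = begin
  reciprocalCoeff s (suc m)
    ≡⟨ levelSum-cong 1 s (suc m) (λ t eq → signedMultinomial-rec t (total-positive 1 t eq)) ⟩
  levelSum 1 s (suc m) (λ t → ℤ.- ∑[ i < s ] (1ℤ ℤ.* lowerAt signedMultinomial i t))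
    ≡⟨ levelSum-∑lowerAt s m (λ _ → 1ℤ) ⟩
  ℤ.- ∑[ j < s ] (1ℤ ℤ.* guard (toℕ j ≤? m) (reciprocalCoeff s (m ∸ toℕ j)))
    ≡⟨ cong ℤ.-_ (∑-cong {s} (λ j → ℤP.*-identityˡ _)) ⟩
  ℤ.- ∑[ j < s ] guard (toℕ j ≤? m) (reciprocalCoeff s (m ∸ toℕ j))
    ∎
  where open ≡-Reasoning

lhs≡-∑reciprocalCoeff : ∀ s m →
  lhs s (suc m) ≡ fromℤ (ℤ.- ∑[ i < s ] (+ suc (toℕ i) ℤ.* guard (toℕ i ≤? m) (reciprocalCoeff s (m ∸ toℕ i))))
lhs≡-∑reciprocalCoeff s m = begin
  sumℚ (map (term k) (filter P? box))
    ≡⟨ cong sumℚ (map-cong-local (All.map (λ {t} → term≡-at t) (all-filter P? box))) ⟩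
  sumℚ (map (λ t → fromℤ (v t)) (filter P? box)) ≡⟨ cong sumℚ (map-∘ {g = fromℤ} {f = v} (filter P? box)) ⟩
  sumℚ (map fromℤ (map v (filter P? box)))       ≡⟨ sumℚ-map-fromℤ (map v (filter P? box)) ⟩
  fromℤ (sumℤ (map v (filter P? box)))           ≡⟨ cong fromℤ (sumℤ-filter P? v box) ⟩
  fromℤ (sumℤ (map (λ t → guard (P? t) (v t)) box)) ≡⟨ cong fromℤ (sumℤ-boxTuples≡levelSum 0 s k k v ≤-refl) ⟩
  fromℤ (levelSum 1 s k v)                       ≡⟨ cong fromℤ (levelSum-∑lowerAt s m (λ i → + suc (toℕ i))) ⟩
  fromℤ (ℤ.- ∑[ i < s ] (+ suc (toℕ i) ℤ.* guard (toℕ i ≤? m) (reciprocalCoeff s (m ∸ toℕ i)))) ∎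
  where
  open ≡-Reasoning
  k = suc m
  box = boxTuples s k
  P? = λ (t : Vec ℕ s) → wsum t ≟ k
  v : Vec ℕ s → ℤ
  v t = ℤ.- ∑[ i < s ] (+ suc (toℕ i) ℤ.* lowerAt signedMultinomial i t)
  term≡-at : ∀ t → wsum t ≡ k → term k t ≡ fromℤ (v t)
  term≡-at t eq = term≡-∑lowerAt k t (total-positive 1 t eq) eq

δ₀ : ℕ → ℤ
δ₀ zero    = 1ℤ
δ₀ (suc _) = 0ℤ

module _ (s′ : ℕ) (E : ℕ → ℤ) (E-0 : E 0 ≡ 1ℤ)
         (E-suc : ∀ m → E (suc m) ≡ ℤ.- ∑[ j < suc s′ ] guard (toℕ j ≤? m) (E (m ∸ toℕ j))) where

  private
    s = suc s′
    p = suc s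

    shifted : ℕ → ℕ → ℤ
    shifted m j = guard (j ≤? m) (E (m ∸ j))

    window : ∀ m → ∑[ j < p ] shifted m (toℕ j) ≡ δ₀ m
    window zero    = trans (cong (ℤ._+_ (E 0)) (∑-zero s (λ j → shifted 0 (suc j)) (λ _ _ → refl)))
                           (trans (ℤP.+-identityʳ (E 0)) E-0)
    window (suc m) = begin
      E (suc m) ℤ.+ ∑[ j < s ] shifted (suc m) (suc (toℕ j))
        ≡⟨ cong₂ ℤ._+_ (E-suc m) (∑-cong {s} (λ j → guard-s≤s (toℕ j) m {E (m ∸ toℕ j)})) ⟩
      ℤ.- S ℤ.+ S                                              ≡⟨ ℤP.+-inverseˡ S ⟩
      0ℤ                                                       ∎
      where
      open ≡-Reasoning
      S = ∑[ j < s ] shifted m (toℕ j)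

    E-step : ∀ m → E (suc m) ≡ shifted m s ℤ.- δ₀ m
    E-step m = begin
      E (suc m)                                         ≡⟨ E-suc m ⟩
      ℤ.- S                                             ≡⟨ -a≡b-[a+b] S (shifted m s) ⟩
      shifted m s ℤ.- (S ℤ.+ shifted m s)
        ≡⟨ cong (ℤ._-_ (shifted m s)) (trans (sym (∑-last s (shifted m))) (window m)) ⟩
      shifted m s ℤ.- δ₀ m                              ∎
      where
      open ≡-Reasoning
      S = ∑[ j < s ] shifted m (toℕ j)
      -a≡b-[a+b] : ∀ a b → ℤ.- a ≡ b ℤ.- (a ℤ.+ b)
      -a≡b-[a+b] = ℤ-Solver.solve-∀

    closed : ℕ → ℤ
    closed n = δ₀ (n % p) ℤ.- δ₀ ((n + s) % p)

    closed-periodic : ∀ r → closed r ≡ closed (r + p)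
    closed-periodic r = cong₂ (λ a b → δ₀ a ℤ.- δ₀ b) (sym ([m+n]%n≡m%n r p)) (sym (begin
      (r + p + s) % p   ≡⟨ cong (_% p) (trans (+-assoc r p s) (trans (cong (_+_ r) (+-comm p s)) (sym (+-assoc r s p)))) ⟩
      (r + s + p) % p   ≡⟨ [m+n]%n≡m%n (r + s) p ⟩
      (r + s) % p       ∎))
      where open ≡-Reasoning

  -- (n + s) % p is (n − 1) mod p, written without truncated subtraction.
  closedForm : ∀ n → E n ≡ δ₀ (n % p) ℤ.- δ₀ ((n + s) % p)
  closedForm = <-rec _ step
    where
    open ≡-Reasoning
    step : ∀ n → (∀ {m} → m < n → E m ≡ closed m) → E n ≡ closed n
    step zero    _   = trans E-0 (cong (λ k → 1ℤ ℤ.- δ₀ k) (sym (m<n⇒m%n≡m (n<1+n s))))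
    step (suc n) rec with s ≤? n
    ... | yes s≤n = begin
      E (suc n)               ≡⟨ E-step n ⟩
      shifted n s ℤ.- δ₀ n    ≡⟨ cong₂ ℤ._-_ (guard-yes (s ≤? n) s≤n) (cong δ₀ (sym (m+[n∸m]≡n s≤n))) ⟩
      E r ℤ.- 0ℤ              ≡⟨ ℤP.+-identityʳ (E r) ⟩
      E r                     ≡⟨ rec (s≤s (m∸n≤m n s)) ⟩
      closed r                ≡⟨ closed-periodic r ⟩
      closed (r + p)          ≡⟨ cong closed (trans (+-suc r s) (cong suc (trans (+-comm r s) (m+[n∸m]≡n s≤n)))) ⟩
      closed (suc n)          ∎
      where r = n ∸ s
    ... | no s≰n = begin
      E (suc n)               ≡⟨ E-step n ⟩
      shifted n s ℤ.- δ₀ n    ≡⟨ cong (ℤ._- δ₀ n) (guard-no (s ≤? n) s≰n) ⟩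
      δ₀ (suc n) ℤ.- δ₀ n     ≡⟨ cong₂ (λ a b → δ₀ a ℤ.- δ₀ b) (sym (m<n⇒m%n≡m (s≤s n<s))) (sym [1+n+s]%p≡n) ⟩
      closed (suc n)          ∎
      where
      n<s = ≰⇒> s≰n
      [1+n+s]%p≡n : (suc n + s) % p ≡ n
      [1+n+s]%p≡n = trans (cong (_% p) (sym (+-suc n s))) (trans ([m+n]%n≡m%n n p) (m<n⇒m%n≡m (m<n⇒m<1+n n<s)))

  private
    weightedWindow : ℕ → ℤ
    weightedWindow m = ∑[ j < s ] (+ suc (toℕ j) ℤ.* shifted m (toℕ j))

    weightedWindow-0 : weightedWindow 0 ≡ 1ℤ
    weightedWindow-0 = cong₂ ℤ._+_ (trans (ℤP.*-identityˡ (E 0)) E-0) (∑-zero s′ _ (λ j _ → ℤP.*-zeroʳ (+ suc (suc j))))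

    weightedWindow-suc : ∀ m → weightedWindow (suc m) ≡ weightedWindow m ℤ.- + p ℤ.* shifted m s′
    weightedWindow-suc m = begin
      1ℤ ℤ.* E (suc m) ℤ.+ ∑[ j < s′ ] (+ suc (suc (toℕ j)) ℤ.* shifted (suc m) (suc (toℕ j)))
        ≡⟨ cong₂ ℤ._+_ (trans (ℤP.*-identityˡ _) (trans (E-suc m) (cong ℤ.-_ (∑-last s′ g))))
                       (trans (∑-cong {s′} (λ j → cong (+ suc (suc (toℕ j)) ℤ.*_) (guard-s≤s (toℕ j) m {E (m ∸ toℕ j)})))
                              (trans (∑-cong {s′} (λ j → split (+ suc (toℕ j)) (g (toℕ j))))
                                     (∑-distrib-+ {s′} (λ j → + suc (toℕ j) ℤ.* g (toℕ j)) (λ j → g (toℕ j))))) ⟩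
      ℤ.- (Y ℤ.+ g s′) ℤ.+ (X ℤ.+ Y)
        ≡⟨ rearrange X Y (g s′) (+ s) ⟩
      (X ℤ.+ + s ℤ.* g s′) ℤ.- + p ℤ.* g s′
        ≡⟨ cong (ℤ._- + p ℤ.* g s′) (∑-last s′ (λ j → + suc j ℤ.* g j)) ⟨
      weightedWindow m ℤ.- + p ℤ.* g s′
        ∎
      where
      open ≡-Reasoning
      g = shifted m
      X = ∑[ j < s′ ] (+ suc (toℕ j) ℤ.* g (toℕ j))
      Y = ∑[ j < s′ ] g (toℕ j)
      split : ∀ a x → (1ℤ ℤ.+ a) ℤ.* x ≡ a ℤ.* x ℤ.+ x
      split = ℤ-Solver.solve-∀
      rearrange : ∀ X Y G S → ℤ.- (Y ℤ.+ G) ℤ.+ (X ℤ.+ Y) ≡ (X ℤ.+ S ℤ.* G) ℤ.- (1ℤ ℤ.+ S) ℤ.* G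
      rearrange = ℤ-Solver.solve-∀

    δ₀-step : ∀ m → δ₀ (suc m % p) ℤ.+ shifted m s′ ≡ δ₀ (suc (suc m) % p)
    δ₀-step m with s′ ≤? m
    ... | yes s′≤m = begin
      δ₀ (suc m % p) ℤ.+ E r
        ≡⟨ cong₂ ℤ._+_ (cong (λ k → δ₀ (k % p)) 1+m≡r+s) (closedForm r) ⟩
      δ₀ ((r + s) % p) ℤ.+ (δ₀ (r % p) ℤ.- δ₀ ((r + s) % p))
        ≡⟨ a+[b-a]≡b (δ₀ ((r + s) % p)) (δ₀ (r % p)) ⟩
      δ₀ (r % p)
        ≡⟨ cong δ₀ ([m+n]%n≡m%n r p) ⟨
      δ₀ ((r + p) % p)
        ≡⟨ cong (λ k → δ₀ (k % p)) (trans (+-suc r s) (cong suc (sym 1+m≡r+s))) ⟩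
      δ₀ (suc (suc m) % p)
        ∎
      where
      open ≡-Reasoning
      r = m ∸ s′
      1+m≡r+s : suc m ≡ r + s
      1+m≡r+s = trans (cong suc (trans (sym (m+[n∸m]≡n s′≤m)) (+-comm s′ r))) (sym (+-suc r s′))
      a+[b-a]≡b : ∀ a b → a ℤ.+ (b ℤ.- a) ≡ b
      a+[b-a]≡b = ℤ-Solver.solve-∀
    ... | no s′≰m = trans (cong (ℤ._+ 0ℤ) (cong δ₀ (m<n⇒m%n≡m (s≤s (s≤s (<⇒≤ m<s′))))))
                          (sym (cong δ₀ (m<n⇒m%n≡m (s≤s (s≤s m<s′)))))
      where m<s′ = ≰⇒> s′≰m

  weightedSum-closedForm : ∀ m →
    ∑[ j < s ] (+ suc (toℕ j) ℤ.* guard (toℕ j ≤? m) (E (m ∸ toℕ j))) ≡ 1ℤ ℤ.- + p ℤ.* δ₀ (suc m % p)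
  weightedSum-closedForm zero    = trans weightedWindow-0 (cong (ℤ._-_ 1ℤ) (sym (ℤP.*-zeroʳ (+ p))))
  weightedSum-closedForm (suc m) = begin
    weightedWindow (suc m)
      ≡⟨ weightedWindow-suc m ⟩
    weightedWindow m ℤ.- + p ℤ.* shifted m s′
      ≡⟨ cong (ℤ._- + p ℤ.* shifted m s′) (weightedSum-closedForm m) ⟩
    1ℤ ℤ.- + p ℤ.* δ₀ (suc m % p) ℤ.- + p ℤ.* shifted m s′
      ≡⟨ factor (+ p) (δ₀ (suc m % p)) (shifted m s′) ⟩
    1ℤ ℤ.- + p ℤ.* (δ₀ (suc m % p) ℤ.+ shifted m s′)
      ≡⟨ cong (λ z → 1ℤ ℤ.- + p ℤ.* z) (δ₀-step m) ⟩
    1ℤ ℤ.- + p ℤ.* δ₀ (suc (suc m) % p)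
      ∎
    where
    open ≡-Reasoning
    factor : ∀ c a b → 1ℤ ℤ.- c ℤ.* a ℤ.- c ℤ.* b ≡ 1ℤ ℤ.- c ℤ.* (a ℤ.+ b)
    factor = ℤ-Solver.solve-∀

corollary2p7 : (k s : ℕ) → .{{NonZero k}} → .{{NonZero s}} →
    (k % suc s ≡ 0 → lhs s k ≡ (+ s) / 1) × (k % suc s ≢ 0 → lhs s k ≡ -1ℤ / 1)
corollary2p7 (suc m) (suc s′) = (λ k≡0 → trans lhs≡value (cong fromℤ (trans (cong value k≡0) (value-zero (+ s)))))
                              , (λ k≢0 → trans lhs≡value (cong fromℤ (value-nonzero _ k≢0)))
  where
  s = suc s′
  value : ℕ → ℤ
  value n = ℤ.- (1ℤ ℤ.- + suc s ℤ.* δ₀ n)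
  lhs≡value : lhs s (suc m) ≡ fromℤ (value (suc m % suc s))
  lhs≡value = trans (lhs≡-∑reciprocalCoeff s m) (cong (λ z → fromℤ (ℤ.- z))
    (weightedSum-closedForm s′ (reciprocalCoeff s) (reciprocalCoeff-0 s) (reciprocalCoeff-suc s) m))
  value-zero : ∀ a → ℤ.- (1ℤ ℤ.- (1ℤ ℤ.+ a) ℤ.* 1ℤ) ≡ a
  value-zero = ℤ-Solver.solve-∀
  value-nonzero : ∀ n → n ≢ 0 → value n ≡ -1ℤ
  value-nonzero zero    n≢0 = contradiction refl n≢0
  value-nonzero (suc n) _   = cong (λ z → ℤ.- (1ℤ ℤ.- z)) (ℤP.*-zeroʳ (+ suc s))
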